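{- Let ${\cal D}$ be a nontrivial regular quadriculated disk and let $c_{\cal D}$ and $m_{N;p_0,p_1}$ be as in the context. Let $(\delta_p)_{p}$ be any family of numbers in $\frac14\mathbb{Z}$ indexed by the plugs $p$, and $N\ge1$ an integer. Then $$c_{\cal D}\le\frac{m}{N},\qquad m=\max_{p_0,p_1}\left(-\delta_{p_0}+m_{N;p_0,p_1}+\delta_{p_1}\right),$$ the maximum over all pairs of plugs.
   Context: A quadriculated disk ${\cal D}\subset\mathbb{R}^2$ is a finite union of unit squares $[a,a+1]\times[b,b+1]$, $(a,b)\in\mathbb{Z}^2$, contractible with contractible interior; squares have color $(-1)^{a+b}$; balanced means equally many squares of each color; nontrivial means at least $6$ squares and some square has at least three neighbours in ${\cal D}$. A plug is a union of squares of ${\cal D}$ with equally many of each color (possibly empty). A floor from plug $p$ to plug $\tilde p$ is a triple $(p,f^*,\tilde p)$ with $p,\tilde p$ having disjoint interiors and $f^*$ a planar domino tiling of ${\cal D}\setminus(p\cup\tilde p)$. A tiling path of length $N$ is a sequence $\Gamma=(p_0,f_1,p_1,\dots,f_N,p_N)$ with $f_j$ a floor from $p_{j-1}$ to $p_j$; closed if $p_N=p_0$; a closed one is simple if $p_0,\dots,p_{N-1}$ are pairwise distinct. Twist of paths: cubes $[a,a+1]\times[b,b+1]\times[c,c+1]$ are black if $a+b+c$ is even, white otherwise; for a 3D domino $d$, $v(d)$ is the unit vector from the center of its white cube to that of its black cube; fix $u\in\{e_1,e_2\}$; ${\cal S}^u(X)=\operatorname{int}((X+[0,\infty)u)\setminus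 X)$; $\tau^u(d_0,d_1)=\frac14\det(v(d_1),v(d_0),u)$ if $d_1\cap{\cal S}^u(d_0)\ne\emptyset$, else $0$. For a planar domino $d$ and unit square $s$ of ${\cal D}$ with disjoint interiors, $\tau^u(d,s)=\tau^u(d\times[0,1],s\times[0,2])+\tau^u(s\times[0,2],d\times[0,1])$; for a floor $f=(p,f^*,\tilde p)$, $\tau^u(f;p,\tilde p)=\sum_{d\in f^*,s\subseteq\tilde p}\tau^u(d,s)-\sum_{d\in f^*,s\subseteq p}\tau^u(d,s)$; $\operatorname{Tw}(\Gamma)=\sum_j\tau^u(f_j;p_{j-1},p_j)$. $c_{\cal D}$ is the maximum of $\operatorname{Tw}(\Gamma)/N$ over simple closed tiling paths $\Gamma$ of length $N\ge1$. $m_{N;p_0,p_1}\in\{ -\infty\}\cup\frac14\mathbb{Z}$ is the maximum of $\operatorname{Tw}(\Gamma)$ over tiling paths of length $N$ from $p_0$ to $p_1$ ($-\infty$ if none); equivalently the matrix $(m_{N;p_0,p_1})$ is the $N$-th power of $(m_{1;p_0,p_1})$ in the tropical semifield ($\oplus=\max$, $\otimes=+$). Regularity: for ${\cal R}_N={\cal D}\times[0,N]$, tilings are $\sim$-equivalent if after appending even numbers of layers of vertical dominoes (equalizing heights) they are joined by flips (replacing two dominoes forming a $2\times2\times1$ box by the other pair); $G_{\cal D}$ is the group of $\sim$-classes under stacking, $G^+_{\cal D}$ the classes of even height; the twist of a tiling ${\mathbf t}$ of ${\cal R}_N$ is $\sum_{d_0,d_1\in{\mathbf t}}\tau^u(d_0,d_1)$,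 inducing $\operatorname{Tw}:G_{\cal D}\to\mathbb{Z}$; ${\cal D}$ is regular if $\operatorname{Tw}:G^+_{\cal D}\to\mathbb{Z}$ is an isomorphism. -}

module Defs where

open import Data.Bool using (Bool; true; false; if_then_else_; _∧_; _∨_; not)
open import Data.Nat as ℕ using (ℕ; zero; suc; _<ᵇ_; _≡ᵇ_; _%_; _∸_)
open import Data.Integer as Z using (ℤ; +_; ∣_∣; _-_; _*_; _≤ᵇ_; 0ℤ)
open import Data.Fin using (Fin; zero; suc; inject₁; fromℕ)
open import Data.Fin.Subset using (Subset; _∈_; _∉_)
open import Data.Vec using (Vec; lookup)
open import Data.List using (List; []; _∷_; map; sum; allFin; upTo; concatMap; filter; length)
open import Data.Product using (Σ; _×_; _,_; proj₁; proj₂; ∃)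
open import Relation.Nullary using (¬_; does)
open import Relation.Binary.PropositionalEquality using (_≡_; _≢_)
open import Relation.Binary.Construct.Closure.ReflexiveTransitive using (Star)

ℤ² : Set
ℤ² = ℤ × ℤ

ℤ³ : Set
ℤ³ = ℤ × ℤ × ℤ

-- two unit squares [a,a+1]×[b,b+1] share an edge
Adj2 : ℤ² → ℤ² → Set
Adj2 (a , b) (a' , b') = ∣ a - a' ∣ ℕ.+ ∣ b - b' ∣ ≡ 1

Adj3 : ℤ³ → ℤ³ → Set
Adj3 (a , b , c) (a' , b' , c') = ∣ a - a' ∣ ℕ.+ ∣ b - b' ∣ ℕ.+ ∣ c - c' ∣ ≡ 1

evenℤ : ℤ → Bool
evenℤ x = ∣ x ∣ % 2 ≡ᵇ 0

-- colour of the square (a,b) is (-1)^(a+b): "even" = colour +1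
evenSq : ℤ² → Bool
evenSq (a , b) = evenℤ (a Z.+ b)

blackCube : ℤ³ → Bool
blackCube (a , b , c) = evenℤ (a Z.+ b Z.+ c)

_==ℤ_ : ℤ → ℤ → Bool
x ==ℤ y = does (x Z.≟ y)

_<ℤ_ : ℤ → ℤ → Bool
x <ℤ y = (x ≤ᵇ y) ∧ not (x ==ℤ y)

_-³_ : ℤ³ → ℤ³ → ℤ³
(a , b , c) -³ (a' , b' , c') = (a - a' , b - b' , c - c')

-- Quadriculated disks
-- The disk is given by an injective enumeration of its n unit squares
-- (square i is [a,a+1]×[b,b+1] with (a,b) = pos i).

InDisk : ∀ {n} → (Fin n → ℤ²) → ℤ² → Set
InDisk pos c = ∃ λ i → pos i ≡ c

record Disk (n : ℕ) : Set where
  field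
    pos       : Fin n → ℤ²
    injective : ∀ i j → pos i ≡ pos j → i ≡ j
    nonempty  : 1 ℕ.≤ n
    connected : ∀ i j → Star (λ k l → Adj2 (pos k) (pos l)) i j
    -- no holes: every square not in the disk is joined, through squares
    -- not in the disk sharing edges, to a square lying to the right of
    -- the whole disk (i.e. to the unbounded complementary component)
    noHoles   : ∀ c → ¬ InDisk pos c →
                ∃ λ c' → (∀ i → proj₁ (pos i) Z.< proj₁ c') ×
                  Star (λ x y → Adj2 x y × ¬ InDisk pos x × ¬ InDisk pos y) c c'

open Disk public

countCol : ∀ {n} → Disk n → Bool → Subset n → ℕ
countCol D col p =
  length (filter (λ i → Data.Bool._≟_ (lookup p i ∧ sameCol i) true) (allFin _))
  where
    import Data.Bool
    sameCol : _ → Bool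
    sameCol i = if col then evenSq (pos D i) else not (evenSq (pos D i))

Nontrivial : ∀ {n} → Disk n → Set
Nontrivial {n} D =
  6 ℕ.≤ n ×
  ∃ λ i → ∃ λ j → ∃ λ k → ∃ λ l →
    j ≢ k × j ≢ l × k ≢ l ×
    Adj2 (pos D i) (pos D j) × Adj2 (pos D i) (pos D k) × Adj2 (pos D i) (pos D l)

IsPlug : ∀ {n} → Disk n → Subset n → Set
IsPlug D p = countCol D true p ≡ countCol D false p

-- Twist of 3D dominoes (all twists are multiplied by 4 to stay in ℤ)

data Dir : Set where
  e₁ e₂ : Dir

dirVec : Dir → ℤ³
dirVec e₁ = (+ 1 , 0ℤ , 0ℤ)
dirVec e₂ = (0ℤ , + 1 , 0ℤ)

record Dom3 : Set where
  constructor dom3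
  field
    white black : ℤ³

vDom : Dom3 → ℤ³
vDom (dom3 w b) = b -³ w

det3 : ℤ³ → ℤ³ → ℤ³ → ℤ
det3 (a₁ , a₂ , a₃) (b₁ , b₂ , b₃) (c₁ , c₂ , c₃) =
  a₁ * (b₂ * c₃ - b₃ * c₂) - a₂ * (b₁ * c₃ - b₃ * c₁) + a₃ * (b₁ * c₂ - b₂ * c₁)
  where open Z using (_+_)

-- cube q lies in the open shadow of cube c in direction u: q = c + k u, k ≥ 1
behind : Dir → ℤ³ → ℤ³ → Bool
behind e₁ (x , y , z) (x' , y' , z') = (y ==ℤ y') ∧ (z ==ℤ z') ∧ (x <ℤ x')
behind e₂ (x , y , z) (x' , y' , z') = (x ==ℤ x') ∧ (z ==ℤ z') ∧ (y <ℤ y')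

meetsShadow : Dir → Dom3 → Dom3 → Bool
meetsShadow u (dom3 w₀ b₀) (dom3 w₁ b₁) =
  behind u w₀ w₁ ∨ behind u w₀ b₁ ∨ behind u b₀ w₁ ∨ behind u b₀ b₁

tau4 : Dir → Dom3 → Dom3 → ℤ
tau4 u d₀ d₁ = if meetsShadow u d₀ d₁ then det3 (vDom d₁) (vDom d₀) (dirVec u) else 0ℤ

mkDom3 : ℤ³ → ℤ³ → Dom3
mkDom3 x y = if blackCube x then dom3 y x else dom3 x y

lift : ℤ² → ℤ → ℤ³
lift (a , b) h = (a , b , h)

tau4plan : Dir → ℤ² → ℤ² → ℤ² → ℤ
tau4plan u x y s =
  tau4 u (mkDom3 (lift x 0ℤ) (lift y 0ℤ)) (mkDom3 (lift s 0ℤ) (lift s (+ 1)))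
  Z.+ tau4 u (mkDom3 (lift s 0ℤ) (lift s (+ 1))) (mkDom3 (lift x 0ℤ) (lift y 0ℤ))

-- Floors and tiling paths
-- A planar domino tiling of D∖(p∪p̃) is given by the partner map m:
-- each free square i is matched with the adjacent free square m i.

inPlug : ∀ {n} → Subset n → Fin n → Bool
inPlug p i = lookup p i

record Floor {n} (D : Disk n) (p p̃ : Subset n) : Set where
  field
    disjoint : ∀ i → i ∈ p → i ∉ p̃
    partner  : Fin n → Fin n
    tiles    : ∀ i → i ∉ p → i ∉ p̃ →
               partner i ∉ p × partner i ∉ p̃ × partner (partner i) ≡ i ×
               Adj2 (pos D i) (pos D (partner i))

open Floor public

sumℤ : List ℤ → ℤ
sumℤ [] = 0ℤ
sumℤ (x ∷ xs) = x Z.+ sumℤ xs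

sumFin : ∀ {n} → (Fin n → ℤ) → ℤ
sumFin {n} f = sumℤ (map f (allFin n))

-- 4 · τ^u(f; p, p̃): each domino is counted once, via its square of colour -1
floorTw4 : ∀ {n} (D : Disk n) → Dir → (p p̃ : Subset n) → Floor D p p̃ → ℤ
floorTw4 D u p p̃ f = sumFin λ i →
  if (inPlug p i ∨ inPlug p̃ i ∨ evenSq (pos D i)) then 0ℤ else
    (sumFin λ s → if inPlug p̃ s then tau4plan u (pos D i) (pos D (partner f i)) (pos D s) else 0ℤ)
    - (sumFin λ s → if inPlug p s then tau4plan u (pos D i) (pos D (partner f i)) (pos D s) else 0ℤ)

record TilingPath {n} (D : Disk n) (N : ℕ) : Set where
  field
    plug    : Fin (suc N) → Subset n
    isPlug  : ∀ j → IsPlug D (plug j)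
    floor   : (j : Fin N) → Floor D (plug (inject₁ j)) (plug (suc j))

open TilingPath public

start end : ∀ {n} {D : Disk n} {N} → TilingPath D N → Subset n
start Γ = plug Γ zero
end {N = N} Γ = plug Γ (fromℕ N)

pathTw4 : ∀ {n} {D : Disk n} {N} → Dir → TilingPath D N → ℤ
pathTw4 {D = D} u Γ = sumFin λ j → floorTw4 D u _ _ (floor Γ j)

Closed : ∀ {n} {D : Disk n} {N} → TilingPath D N → Set
Closed Γ = end Γ ≡ start Γ

Simple : ∀ {n} {D : Disk n} {N} → TilingPath D N → Set
Simple {N = N} Γ = ∀ (i j : Fin N) → plug Γ (inject₁ i) ≡ plug Γ (inject₁ j) → i ≡ j

-- Tilings of R_N = D × [0,N] and regularity
-- Cube (i,h) is s_i × [h,h+1]. A tiling is a partner map on cubes,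
-- equal to the identity outside the region.

Cube : ℕ → Set
Cube n = Fin n × ℕ

cubePos : ∀ {n} → Disk n → Cube n → ℤ³
cubePos D (i , h) = lift (pos D i) (+ h)

record Tiling3 {n} (D : Disk n) (N : ℕ) : Set where
  field
    part   : Cube n → Cube n
    inside : ∀ i h → h ℕ.< N →
             proj₂ (part (i , h)) ℕ.< N × part (part (i , h)) ≡ (i , h) ×
             Adj3 (cubePos D (i , h)) (cubePos D (part (i , h)))
    outside : ∀ i h → N ℕ.≤ h → part (i , h) ≡ (i , h)

open Tiling3 public

-- 4 · twist of a tiling: sum over ordered pairs of dominoes, each domino
-- represented by its white cube
tiling3Tw4 : ∀ {n} {D : Disk n} {N} → Dir → Tiling3 D N → ℤ
tiling3Tw4 {n} {D} {N} u t = sumCubes λ x → sumCubes λ y → tau4 u (dom x) (dom y)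
  where
    dom : Cube n → Dom3
    dom x = mkDom3 (cubePos D x) (cubePos D (part t x))
    white : Cube n → Bool
    white x = not (blackCube (cubePos D x))
    sumCubes : (Cube n → ℤ) → ℤ
    sumCubes f = sumFin λ i → sumℤ (map (λ h → if white (i , h) then f (i , h) else 0ℤ) (upTo N))

Flip : ∀ {n} → Disk n → (Cube n → Cube n) → (Cube n → Cube n) → Set
Flip {n} D t t' = ∃ λ (abcd : Cube n × Cube n × Cube n × Cube n) →
  let (a , b , c , d) = abcd in
  Adj3 (cubePos D a) (cubePos D b) × Adj3 (cubePos D b) (cubePos D c) ×
  Adj3 (cubePos D c) (cubePos D d) × Adj3 (cubePos D d) (cubePos D a) ×
  t a ≡ b × t b ≡ a × t c ≡ d × t d ≡ c ×
  t' a ≡ d × t' d ≡ a × t' b ≡ c × t' c ≡ b ×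
  (∀ x → x ≢ a → x ≢ b → x ≢ c → x ≢ d → t' x ≡ t x)

isEvenℕ : ℕ → Bool
isEvenℕ h = h % 2 ≡ᵇ 0

-- append 2k layers of vertical dominoes on top of a tiling of height N
appendVert : ∀ {n} → ℕ → ℕ → (Cube n → Cube n) → (Cube n → Cube n)
appendVert N k t (i , h) =
  if h <ᵇ N then t (i , h)
  else if h <ᵇ N ℕ.+ 2 ℕ.* k then
    (if isEvenℕ (h ∸ N) then (i , suc h) else (i , h ∸ 1))
  else (i , h)

_∼_ : ∀ {n} {D : Disk n} {N₁ N₂} → Tiling3 D N₁ → Tiling3 D N₂ → Set
_∼_ {D = D} {N₁} {N₂} t₁ t₂ = ∃ λ k₁ → ∃ λ k₂ →
  N₁ ℕ.+ 2 ℕ.* k₁ ≡ N₂ ℕ.+ 2 ℕ.* k₂ ×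
  Star (Flip D) (appendVert N₁ k₁ (part t₁)) (appendVert N₂ k₂ (part t₂))

-- Tw : G⁺_D → ℤ is a bijection (on ∼-classes of tilings of even height)
Regular : ∀ {n} → Disk n → Dir → Set
Regular D u =
  (∀ M₁ M₂ (t₁ : Tiling3 D (2 ℕ.* M₁)) (t₂ : Tiling3 D (2 ℕ.* M₂)) →
     tiling3Tw4 u t₁ ≡ tiling3Tw4 u t₂ → t₁ ∼ t₂) ×
  (∀ (z : ℤ) → ∃ λ M → Σ (Tiling3 D (2 ℕ.* M)) λ t → tiling3Tw4 u t ≡ + 4 * z)

-- Repeat the closed path Γ of length L periodically and cut its first L·N
-- floors into L consecutive segments of length N.  The segments' twists add
-- up to N·Tw(Γ), and their corrections -δ(start) + δ(end) telescope to 0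
-- because after L·N floors the path is back at its initial plug; so some
-- segment has corrected twist at least N·Tw(Γ)/L.
module Submission where

open import Defs
open import Data.Nat using (ℕ)
import Data.Nat as ℕ
open import Data.Integer using (ℤ; +_; _*_; _+_; -_; _≤_)
open import Data.Fin.Subset using (Subset)
open import Data.Product using (Σ; ∃; _×_)
open import Relation.Binary.PropositionalEquality using (_≡_)

open import Data.Nat using (zero; suc)
import Data.Nat.Properties as ℕP
open import Data.Nat.DivMod using (_mod_; _%_; _/_; m≡m%n+[m/n]*n; [m+kn]%n≡m%n; m%n<n; m<n⇒m%n≡m; n%n≡0)
open import Data.Integer using (0ℤ)
import Data.Integer.Properties as ℤP
open import Data.Integer.Tactic.RingSolver using (solve-∀)
open import Data.Fin using (Fin; suc; toℕ; inject₁)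
import Data.Fin.Properties as FinP
open import Data.List using (tabulate)
import Data.List.Properties as ListP
open import Data.Product using (_,_; proj₁; proj₂)
open import Data.Sum using (inj₁; inj₂)
open import Function using (_∘_; id)
open import Relation.Binary.PropositionalEquality
  using (refl; sym; trans; cong; cong₂; subst₂; module ≡-Reasoning)
open import Relation.Nullary using (yes; no)

∑ : ℕ → (ℕ → ℤ) → ℤ
∑ zero    f = 0ℤ
∑ (suc k) f = ∑ k f + f k

syntax ∑ k (λ i → e) = ∑[ i < k ] e

∑-cong : ∀ k {f g : ℕ → ℤ} → (∀ i → f i ≡ g i) → ∑ k f ≡ ∑ k g
∑-cong zero    f≡g = refl
∑-cong (suc k) f≡g = cong₂ _+_ (∑-cong k f≡g) (f≡g k)

∑-split : ∀ m n (f : ℕ → ℤ) → ∑ (m ℕ.+ n) f ≡ ∑ n f + ∑[ i < m ] f (i ℕ.+ n)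
∑-split zero    n f = sym (ℤP.+-identityʳ (∑ n f))
∑-split (suc m) n f =
  trans (cong (_+ f (m ℕ.+ n)) (∑-split m n f)) (ℤP.+-assoc (∑ n f) _ _)

∑-head : ∀ k (f : ℕ → ℤ) → ∑ (suc k) f ≡ f 0 + ∑ k (f ∘ suc)
∑-head zero    f = trans (ℤP.+-identityˡ (f 0)) (sym (ℤP.+-identityʳ (f 0)))
∑-head (suc k) f = trans (cong (_+ f (suc k)) (∑-head k f)) (ℤP.+-assoc (f 0) _ _)

∑-const : ∀ k (c : ℤ) → ∑[ _ < k ] c ≡ + k * c
∑-const zero    c = sym (ℤP.*-zeroˡ c)
∑-const (suc k) c = begin
  ∑ k (λ _ → c) + c  ≡⟨ cong (_+ c) (∑-const k c) ⟩
  + k * c + c        ≡⟨ ℤP.+-comm (+ k * c) c ⟩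
  c + + k * c        ≡⟨ sym (ℤP.suc-* (+ k) c) ⟩
  + suc k * c        ∎
  where open ≡-Reasoning

∑-blocks : ∀ K N (f : ℕ → ℤ) → ∑ (K ℕ.* N) f ≡ ∑[ k < K ] ∑[ j < N ] f (j ℕ.+ k ℕ.* N)
∑-blocks zero    N f = refl
∑-blocks (suc K) N f =
  trans (∑-split N (K ℕ.* N) f) (cong (_+ ∑ N (λ j → f (j ℕ.+ K ℕ.* N))) (∑-blocks K N f))

∑-periodic : ∀ M L (f : ℕ → ℤ) → (∀ i k → f (i ℕ.+ k ℕ.* L) ≡ f i) →
             ∑ (M ℕ.* L) f ≡ + M * ∑ L f
∑-periodic M L f periodic =
  trans (∑-blocks M L f) (trans (∑-cong M (λ k → ∑-cong L (λ j → periodic j k))) (∑-const M (∑ L f)))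

∑-telescope : ∀ k (d f : ℕ → ℤ) → ∑[ i < k ] (- d i + f i + d (suc i)) ≡ - d 0 + ∑ k f + d k
∑-telescope zero    d f = sym (trans (cong (_+ d 0) (ℤP.+-identityʳ (- d 0))) (ℤP.+-inverseˡ (d 0)))
∑-telescope (suc k) d f =
  trans (cong (_+ (- d k + f k + d (suc k))) (∑-telescope k d f))
        (regroup (d 0) (∑ k f) (d k) (f k) (d (suc k)))
  where
  regroup : ∀ a s b x c → - a + s + b + (- b + x + c) ≡ - a + (s + x) + c
  regroup = solve-∀

∑-≤-*-step : ∀ l (f : ℕ → ℤ) {a b} → ∑ (suc l) f ≤ + suc l * a → a ≤ b → f (suc l) ≤ b →
             ∑ (suc (suc l)) f ≤ + suc (suc l) * b
∑-≤-*-step l f {a} {b} ∑≤ a≤b fl≤b = begin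
  ∑ (suc l) f + f (suc l)  ≤⟨ ℤP.+-mono-≤ (ℤP.≤-trans ∑≤ (ℤP.*-monoˡ-≤-nonNeg (+ suc l) a≤b)) fl≤b ⟩
  + suc l * b + b          ≡⟨ ℤP.+-comm (+ suc l * b) b ⟩
  b + + suc l * b          ≡⟨ sym (ℤP.suc-* (+ suc l) b) ⟩
  + suc (suc l) * b        ∎
  where open ℤP.≤-Reasoning

∃-term-≥-average : ∀ l (f : ℕ → ℤ) → ∃ λ k → ∑ (suc l) f ≤ + suc l * f k
∃-term-≥-average zero    f =
  0 , ℤP.≤-reflexive (trans (ℤP.+-identityˡ (f 0)) (sym (ℤP.*-identityˡ (f 0))))
∃-term-≥-average (suc l) f with ∃-term-≥-average l f
... | k , ∑≤ with f k ℤP.≤? f (suc l)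
...   | yes fk≤fl = suc l , ∑-≤-*-step l f ∑≤ fk≤fl ℤP.≤-refl
...   | no  fk≰fl = k , ∑-≤-*-step l f ∑≤ ℤP.≤-refl (ℤP.<⇒≤ (ℤP.≰⇒> fk≰fl))

sumℤ-tabulate : ∀ k (f : ℕ → ℤ) → sumℤ (tabulate {n = k} (f ∘ toℕ)) ≡ ∑ k f
sumℤ-tabulate zero    f = refl
sumℤ-tabulate (suc k) f = trans (cong (λ s → f 0 + s) (sumℤ-tabulate k (f ∘ suc))) (sym (∑-head k f))

sumFin≡∑ : ∀ k (g : Fin k → ℤ) (f : ℕ → ℤ) → (∀ i → g i ≡ f (toℕ i)) → sumFin g ≡ ∑ k f
sumFin≡∑ k g f g≡f = trans (cong sumℤ (trans (ListP.map-tabulate id g) (ListP.tabulate-cong g≡f)))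
                           (sumℤ-tabulate k f)

floorTw4-subst₂ : ∀ {n} (D : Disk n) u {p p′ q q′ : Subset n} (p≡p′ : p ≡ p′) (q≡q′ : q ≡ q′)
                  (f : Floor D p q) →
                  floorTw4 D u p′ q′ (subst₂ (Floor D) p≡p′ q≡q′ f) ≡ floorTw4 D u p q f
floorTw4-subst₂ D u refl refl f = refl

correctedTw4 : ∀ {n} {D : Disk n} {N} → Dir → (Subset n → ℤ) → TilingPath D N → ℤ
correctedTw4 u δ Γ = - δ (start Γ) + pathTw4 u Γ + δ (end Γ)

record InfinitePath {n} (D : Disk n) : Set where
  field
    plugAt   : ℕ → Subset n
    isPlugAt : ∀ m → IsPlug D (plugAt m)
    floorAt  : ∀ m → Floor D (plugAt m) (plugAt (suc m))

open InfinitePath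

module _ {n} {D : Disk n} (ω : InfinitePath D) where

  floorTw4At : Dir → ℕ → ℤ
  floorTw4At u m = floorTw4 D u _ _ (floorAt ω m)

  segment : (a N : ℕ) → TilingPath D N
  segment a N = record
    { plug   = λ j → plugAt ω (toℕ j ℕ.+ a)
    ; isPlug = λ j → isPlugAt ω _
    ; floor  = λ j → subst₂ (Floor D) (inject₁-shift j) refl (floorAt ω (toℕ j ℕ.+ a))
    }
    where
    inject₁-shift : ∀ {N} (j : Fin N) → plugAt ω (toℕ j ℕ.+ a) ≡ plugAt ω (toℕ (inject₁ j) ℕ.+ a)
    inject₁-shift j = cong (λ i → plugAt ω (i ℕ.+ a)) (sym (FinP.toℕ-inject₁ j))

  end-segment : ∀ a N → end (segment a N) ≡ plugAt ω (N ℕ.+ a)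
  end-segment a N = cong (λ i → plugAt ω (i ℕ.+ a)) (FinP.toℕ-fromℕ N)

  pathTw4-segment : ∀ u a N → pathTw4 u (segment a N) ≡ ∑[ j < N ] floorTw4At u (j ℕ.+ a)
  pathTw4-segment u a N =
    sumFin≡∑ N _ _ λ j → floorTw4-subst₂ D u _ refl (floorAt ω (toℕ j ℕ.+ a))

module _ {n} {D : Disk n} {l} (Γ : TilingPath D (suc l)) where

  private
    L : ℕ
    L = suc l

    mod-cong : ∀ m m′ → m % L ≡ m′ % L → m mod L ≡ m′ mod L
    mod-cong m m′ e = FinP.fromℕ<-cong _ _ e (m%n<n m L) (m%n<n m′ L)

  cyclePlug : ℕ → Subset n
  cyclePlug m = plug Γ (inject₁ (m mod L))

  cyclePlug-% : ∀ m m′ → m % L ≡ m′ % L → cyclePlug m ≡ cyclePlug m′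
  cyclePlug-% m m′ e = cong (plug Γ ∘ inject₁) (mod-cong m m′ e)

  cyclePlug-periodic : ∀ m k → cyclePlug (m ℕ.+ k ℕ.* L) ≡ cyclePlug m
  cyclePlug-periodic m k = cyclePlug-% (m ℕ.+ k ℕ.* L) m ([m+kn]%n≡m%n m k L)

  module _ (closed : Closed Γ) where

    plug≡cyclePlug : ∀ i → plug Γ i ≡ cyclePlug (toℕ i)
    plug≡cyclePlug i with ℕP.m<1+n⇒m<n∨m≡n (FinP.toℕ<n i)
    ... | inj₁ i<L = cong (plug Γ) (FinP.toℕ-injective (sym (begin
      toℕ (inject₁ (toℕ i mod L))  ≡⟨ FinP.toℕ-inject₁ _ ⟩
      toℕ (toℕ i mod L)            ≡⟨ FinP.toℕ-fromℕ< _ ⟩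
      toℕ i % L                    ≡⟨ m<n⇒m%n≡m i<L ⟩
      toℕ i                        ∎)))
      where open ≡-Reasoning
    ... | inj₂ i≡L = begin
      plug Γ i            ≡⟨ cong (plug Γ) (FinP.toℕ-injective (trans i≡L (sym (FinP.toℕ-fromℕ L)))) ⟩
      end Γ               ≡⟨ closed ⟩
      cyclePlug 0         ≡⟨ cyclePlug-% 0 (toℕ i) (sym (trans (cong (_% L) i≡L) (n%n≡0 L))) ⟩
      cyclePlug (toℕ i)   ∎
      where open ≡-Reasoning

    suc-cyclePlug : ∀ m → plug Γ (suc (m mod L)) ≡ cyclePlug (suc m)
    suc-cyclePlug m = trans (plug≡cyclePlug (suc (m mod L)))
                            (cyclePlug-% (suc (toℕ (m mod L))) (suc m) (begin
      suc (toℕ (m mod L)) % L            ≡⟨ cong (λ r → suc r % L) (FinP.toℕ-fromℕ< _) ⟩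
      suc (m % L) % L                    ≡⟨ [m+kn]%n≡m%n (suc (m % L)) (m / L) L ⟨
      (suc (m % L) ℕ.+ m / L ℕ.* L) % L  ≡⟨ cong (λ r → suc r % L) (m≡m%n+[m/n]*n m L) ⟨
      suc m % L                          ∎))
      where open ≡-Reasoning

    cycle : InfinitePath D
    cycle = record
      { plugAt   = cyclePlug
      ; isPlugAt = λ m → isPlug Γ _
      ; floorAt  = λ m → subst₂ (Floor D) refl (suc-cyclePlug m) (floor Γ (m mod L))
      }

    floorTw4At-cycle : ∀ u m → floorTw4At cycle u m ≡ floorTw4 D u _ _ (floor Γ (m mod L))
    floorTw4At-cycle u m = floorTw4-subst₂ D u refl (suc-cyclePlug m) (floor Γ (m mod L))

    floorTw4At-cycle-periodic : ∀ u m k → floorTw4At cycle u (m ℕ.+ k ℕ.* L) ≡ floorTw4At cycle u m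
    floorTw4At-cycle-periodic u m k = begin
      floorTw4At cycle u (m ℕ.+ k ℕ.* L)                   ≡⟨ floorTw4At-cycle u _ ⟩
      floorTw4 D u _ _ (floor Γ ((m ℕ.+ k ℕ.* L) mod L))  ≡⟨ cong (floorTw4 D u _ _ ∘ floor Γ) mod-periodic ⟩
      floorTw4 D u _ _ (floor Γ (m mod L))                 ≡⟨ floorTw4At-cycle u m ⟨
      floorTw4At cycle u m                                 ∎
      where
      open ≡-Reasoning
      mod-periodic : (m ℕ.+ k ℕ.* L) mod L ≡ m mod L
      mod-periodic = mod-cong (m ℕ.+ k ℕ.* L) m ([m+kn]%n≡m%n m k L)

    pathTw4≡∑-cycle : ∀ u → pathTw4 u Γ ≡ ∑ L (floorTw4At cycle u)
    pathTw4≡∑-cycle u = sumFin≡∑ L _ _ λ i →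
      sym (trans (floorTw4At-cycle u (toℕ i)) (cong (floorTw4 D u _ _ ∘ floor Γ) (toℕ-mod i)))
      where
      toℕ-mod : ∀ (i : Fin L) → toℕ i mod L ≡ i
      toℕ-mod i = FinP.toℕ-injective (trans (FinP.toℕ-fromℕ< _) (m<n⇒m%n≡m (FinP.toℕ<n i)))

    ∑-correctedTw4-segments : ∀ u δ N →
      ∑[ k < L ] correctedTw4 u δ (segment cycle (k ℕ.* N) N) ≡ + N * pathTw4 u Γ
    ∑-correctedTw4-segments u δ N = begin
      ∑[ k < L ] correctedTw4 u δ (segment cycle (k ℕ.* N) N)  ≡⟨ ∑-cong L segment-terms ⟩
      ∑[ k < L ] (- d k + B k + d (suc k))                      ≡⟨ ∑-telescope L d B ⟩
      - d 0 + ∑ L B + d L                                       ≡⟨ cong (λ x → - d 0 + ∑ L B + x) returns ⟩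
      - d 0 + ∑ L B + d 0                                       ≡⟨ cancel (d 0) (∑ L B) ⟩
      ∑ L B                                                     ≡⟨ ∑-blocks L N T ⟨
      ∑ (L ℕ.* N) T                                             ≡⟨ cong (λ m → ∑ m T) (ℕP.*-comm L N) ⟩
      ∑ (N ℕ.* L) T                                             ≡⟨ ∑-periodic N L T (floorTw4At-cycle-periodic u) ⟩
      + N * ∑ L T                                               ≡⟨ cong (+ N *_) (pathTw4≡∑-cycle u) ⟨
      + N * pathTw4 u Γ                                         ∎
      where
      open ≡-Reasoning
      T : ℕ → ℤ
      T = floorTw4At cycle u
      B : ℕ → ℤ
      B k = ∑[ j < N ] T (j ℕ.+ k ℕ.* N)
      d : ℕ → ℤ
      d k = δ (cyclePlug (k ℕ.* N))
      segment-terms : ∀ k → correctedTw4 u δ (segment cycle (k ℕ.* N) N) ≡ - d k + B k + d (suc k)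
      segment-terms k = cong₂ (λ t p → - d k + t + δ p)
        (pathTw4-segment cycle u (k ℕ.* N) N) (end-segment cycle (k ℕ.* N) N)
      returns : d L ≡ d 0
      returns = cong δ (trans (cong cyclePlug (ℕP.*-comm L N)) (cyclePlug-periodic 0 N))
      cancel : ∀ a x → - a + x + a ≡ x
      cancel = solve-∀

lemma11p2 : ∀ {n} (D : Disk n) → Nontrivial D → (u : Dir) → Regular D u →
    (δ₄ : Subset n → ℤ) → (N : ℕ) → 1 ℕ.≤ N →
    ∀ (L : ℕ) → 1 ℕ.≤ L → (Γ : TilingPath D L) → Closed Γ → Simple Γ →
    Σ (TilingPath D N) λ Γ' →
      + N * pathTw4 u Γ ≤ + L * (- δ₄ (start Γ') + pathTw4 u Γ' + δ₄ (end Γ'))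
lemma11p2 D _ u _ δ₄ N _ (suc l) _ Γ closed _ = segment ω (k ℕ.* N) N , (begin
  + N * pathTw4 u Γ        ≡⟨ ∑-correctedTw4-segments Γ closed u δ₄ N ⟨
  ∑ (suc l) segmentTw4     ≤⟨ proj₂ above-average ⟩
  + suc l * segmentTw4 k   ∎)
  where
  open ℤP.≤-Reasoning
  ω : InfinitePath D
  ω = cycle Γ closed
  segmentTw4 : ℕ → ℤ
  segmentTw4 k = correctedTw4 u δ₄ (segment ω (k ℕ.* N) N)
  above-average : ∃ λ k → ∑ (suc l) segmentTw4 ≤ + suc l * segmentTw4 k
  above-average = ∃-term-≥-average l segmentTw4
  k : ℕ
  k = proj₁ above-average
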